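{- Let $N=(S,T,F,M_0)$ be a binary-conflict-free net, $\sigma\in T^*$, $t,u\in T$ with $t\ne u$, and $\sigma t,\sigma u\in\mathrm{FS}(N)$. Then $\sigma tu,\sigma ut\in\mathrm{FS}(N)$ and $\sigma tu\equiv_0^*\sigma ut$.
   Context: A net is $N=(S,T,F,M_0)$ with $S,T$ disjoint, $F:(S\times T)\cup(T\times S)\to\mathbb{N}$, $M_0:S\to\mathbb{N}$, each transition having finitely many and at least one preplace and finitely many postplaces. ${}^\bullet x(y)=F(y,x)$, $x^\bullet(y)=F(x,y)$ (multisets), extended additively to finite multisets. For markings $M,M'$ and finite non-empty multiset $G$ of transitions, $M\xrightarrow{G}M'$ iff ${}^\bullet G\le M$ and $M'=(M-{}^\bullet G)+G^\bullet$. For a finite or infinite word $\sigma=t_1t_2\cdots$, $M\xrightarrow{\sigma}$ means $M\xrightarrow{\{t_1\}}M_1\xrightarrow{\{t_2\}}\cdots$. $\mathrm{FS}^\infty(N)$: words with $M_0\xrightarrow{\sigma}$; $\mathrm{FS}(N)$: finite ones; reachable markings are those $M$ with $M_0\xrightarrow{\sigma}M$ for some finite $\sigma$. A finite non-empty multiset $G$ of transitions is in semantic conflict in $M$ iff not $M\xrightarrow{G}$ but $M\xrightarrow{G\restriction\{t\}}$ for every $t\in G$; $N$ is binary-conflict-free iff no $G$ with $|G|=2$ is in semantic conflict in any reachable marking. For $\sigma,\rho\in\mathrm{FS}^\infty(N)$, $\sigma\equiv_0\rho$ iff $\sigma=\alpha tu\beta$, $\rho=\alpha ut\beta$ and $M_0\xrightarrow{\alpha}M\xrightarrow{\{t,u\}}$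 for some $M$; $\equiv_0^*$ is its reflexive transitive closure. -}

module Defs where

open import Data.Nat using (ℕ; zero; suc; _+_; _∸_; _≤_; _<_)
open import Data.List using (List; []; _∷_; _++_; length; [_])
open import Data.List.Membership.Propositional using (_∈_)
open import Data.Product using (Σ; ∃; ∃-syntax; _×_; _,_)
open import Relation.Binary.PropositionalEquality using (_≡_; _≢_)
open import Relation.Nullary using (¬_)
open import Relation.Binary.Construct.Closure.ReflexiveTransitive using (Star)

-- A net N = (S, T, F, M0).  F is split into its two halves:
--   pre  t s = F(s,t)   (the multiset •t)
--   post t s = F(t,s)   (the multiset t•)
record Net : Set₁ where
  field
    S    : Set
    T    : Set
    pre  : T → S → ℕ
    post : T → S → ℕ
    M₀   : S → ℕ
    pre-finite  : (t : T) → ∃[ ps ] (∀ s → 0 < pre t s → s ∈ ps)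
    post-finite : (t : T) → ∃[ ps ] (∀ s → 0 < post t s → s ∈ ps)
    pre-nonempty : (t : T) → ∃[ s ] (0 < pre t s)

module _ (N : Net) where
  open Net N

  Marking : Set
  Marking = S → ℕ

  -- Finite multisets of transitions are represented by lists (order irrelevant
  -- for everything below, as all notions only use the additive extensions).
  MSet : Set
  MSet = List T

  preM : MSet → S → ℕ
  preM []      s = 0
  preM (t ∷ G) s = pre t s + preM G s

  postM : MSet → S → ℕ
  postM []      s = 0
  postM (t ∷ G) s = post t s + postM G s

  Fires : Marking → MSet → Marking → Set
  Fires M G M' = (∀ s → preM G s ≤ M s) × (∀ s → M' s ≡ (M s ∸ preM G s) + postM G s)

  Enabled : Marking → MSet → Set
  Enabled M G = ∃[ M' ] Fires M G M'

  data FiresSeq : Marking → List T → Marking → Set where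
    done : ∀ {M M'} → (∀ s → M' s ≡ M s) → FiresSeq M [] M'
    step : ∀ {M M₁ M' t σ} → Fires M [ t ] M₁ → FiresSeq M₁ σ M' → FiresSeq M (t ∷ σ) M'

  FS : List T → Set
  FS σ = ∃[ M ] FiresSeq M₀ σ M

  Reachable : Marking → Set
  Reachable M = ∃[ σ ] FiresSeq M₀ σ M

  data Restrict : MSet → T → MSet → Set where
    r-nil  : ∀ {t} → Restrict [] t []
    r-keep : ∀ {t G H} → Restrict G t H → Restrict (t ∷ G) t (t ∷ H)
    r-drop : ∀ {t u G H} → u ≢ t → Restrict G t H → Restrict (u ∷ G) t H

  SemConflict : Marking → MSet → Set
  SemConflict M G =
    (G ≢ []) × ¬ Enabled M G ×
    (∀ t → t ∈ G → ∃[ H ] (Restrict G t H × Enabled M H))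

  BinaryConflictFree : Set
  BinaryConflictFree =
    ∀ M G → Reachable M → length G ≡ 2 → ¬ SemConflict M G

  Equiv₀ : List T → List T → Set
  Equiv₀ σ ρ = FS σ × FS ρ ×
    ∃[ α ] ∃[ t ] ∃[ u ] ∃[ β ]
      (σ ≡ α ++ (t ∷ u ∷ β)) × (ρ ≡ α ++ (u ∷ t ∷ β)) ×
      ∃[ M ] (FiresSeq M₀ α M × Enabled M (t ∷ u ∷ []))

  Equiv₀* : List T → List T → Set
  Equiv₀* = Star Equiv₀

{-# OPTIONS --safe #-}
module Submission where

open import Defs
open import Data.Nat using (z≤n; _+_; _∸_; _≤_; _≤?_)
open import Data.Nat.Properties
  using (+-comm; +-assoc; +-commutativeSemigroup; +-monoʳ-≤; m≤m+n; m+n≤o⇒m≤o∸n; ≤-trans)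
open import Algebra.Properties.CommutativeSemigroup +-commutativeSemigroup using (x∙yz≈y∙xz)
open import Data.List using (List; _∷_; []; _++_; [_])
open import Data.List.Membership.Propositional using (_∈_)
open import Data.List.Relation.Unary.Any using (here; there)
open import Data.Product using (∃-syntax; _×_; _,_)
open import Relation.Binary.PropositionalEquality
  using (_≡_; _≢_; _≗_; refl; sym; trans; cong; subst)
open import Relation.Binary.Construct.Closure.ReflexiveTransitive using (ε; _◅_)
open import Relation.Nullary using (¬_)
open import Relation.Nullary.Decidable using (decidable-stable)

-- Both orders of firing t and u are obtained by sequentialising the step {t, u}, which is
-- enabled after σ: otherwise {t, u} would be a binary semantic conflict, as t and u are each
-- enabled there (the marking reached by σ is unique).  The step also witnesses σtu ≡₀ σut.

≤-∸-+ : ∀ {a b m} c → a + b ≤ m → b ≤ (m ∸ a) + c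
≤-∸-+ {a} {b} {m} c a+b≤m =
  ≤-trans (m+n≤o⇒m≤o∸n b (subst (_≤ m) (+-comm a b) a+b≤m)) (m≤m+n (m ∸ a) c)

module Firing (N : Net) where
  open Net N

  preM-++ : ∀ G H s → preM N (G ++ H) s ≡ preM N G s + preM N H s
  preM-++ []      H s = refl
  preM-++ (t ∷ G) H s = trans (cong (pre t s +_) (preM-++ G H s)) (sym (+-assoc (pre t s) _ _))

  enabled : ∀ {M} G → (∀ s → preM N G s ≤ M s) → Enabled N M G
  enabled _ ≤M = _ , ≤M , λ _ → refl

  Enabled-swap : ∀ {M t u G} → Enabled N M (t ∷ u ∷ G) → Enabled N M (u ∷ t ∷ G)
  Enabled-swap {M} {t} {u} {G} (_ , ≤M , _) =
    enabled (u ∷ t ∷ G) λ s → subst (_≤ M s) (x∙yz≈y∙xz (pre t s) (pre u s) (preM N G s)) (≤M s)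

  Fires-resp : ∀ {M₁ M₂ G M'} → M₁ ≗ M₂ → Fires N M₂ G M' → Fires N M₁ G M'
  Fires-resp {G = G} M₁≗M₂ (≤M , eq) =
    (λ s → subst (_ ≤_) (sym (M₁≗M₂ s)) (≤M s)) ,
    (λ s → trans (eq s) (cong (λ m → (m ∸ preM N G s) + postM N G s) (sym (M₁≗M₂ s))))

  Fires-deterministic : ∀ {M₁ M₂ G A B} → M₁ ≗ M₂ → Fires N M₁ G A → Fires N M₂ G B → A ≗ B
  Fires-deterministic {G = G} M₁≗M₂ (_ , eqA) (_ , eqB) s =
    trans (eqA s) (trans (cong (λ m → (m ∸ preM N G s) + postM N G s) (M₁≗M₂ s)) (sym (eqB s)))

  FiresSeq-resp : ∀ {M₁ M₂ σ M'} → M₁ ≗ M₂ → FiresSeq N M₂ σ M' → FiresSeq N M₁ σ M'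
  FiresSeq-resp M₁≗M₂ (done eq)  = done (λ s → trans (eq s) (sym (M₁≗M₂ s)))
  FiresSeq-resp M₁≗M₂ (step {t = t} f r) = step (Fires-resp {G = [ t ]} M₁≗M₂ f) r

  FiresSeq-deterministic : ∀ {M₁ M₂ σ A B} → M₁ ≗ M₂ → FiresSeq N M₁ σ A → FiresSeq N M₂ σ B → A ≗ B
  FiresSeq-deterministic M₁≗M₂ (done eqA) (done eqB) s = trans (eqA s) (trans (M₁≗M₂ s) (sym (eqB s)))
  FiresSeq-deterministic M₁≗M₂ (step {t = t} f r) (step g q) =
    FiresSeq-deterministic (Fires-deterministic {G = [ t ]} M₁≗M₂ f g) r q

  FiresSeq-++⁺ : ∀ {M M₁ M'} σ {τ} → FiresSeq N M σ M₁ → FiresSeq N M₁ τ M' → FiresSeq N M (σ ++ τ) M'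
  FiresSeq-++⁺ []      (done eq)  r = FiresSeq-resp (λ s → sym (eq s)) r
  FiresSeq-++⁺ (_ ∷ σ) (step f a) r = step f (FiresSeq-++⁺ σ a r)

  FiresSeq-snoc⁻ : ∀ {M M'} σ {t} → FiresSeq N M (σ ++ [ t ]) M' →
                   ∃[ M₁ ] FiresSeq N M σ M₁ × Enabled N M₁ [ t ]
  FiresSeq-snoc⁻ []      (step f _) = _ , done (λ _ → refl) , _ , f
  FiresSeq-snoc⁻ (_ ∷ σ) (step f r) with FiresSeq-snoc⁻ σ r
  ... | M₁ , a , en = M₁ , step f a , en

  Enabled-resp : ∀ {M₁ M₂} G → M₁ ≗ M₂ → Enabled N M₂ G → Enabled N M₁ G
  Enabled-resp G M₁≗M₂ (M' , f) = M' , Fires-resp {G = G} M₁≗M₂ f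

  Enabled⇒FiresSeq : ∀ {M} G → Enabled N M G → ∃[ M' ] FiresSeq N M G M'
  Enabled⇒FiresSeq []      _ = _ , done (λ _ → refl)
  Enabled⇒FiresSeq {M} (t ∷ G) (_ , ≤M , _) with Enabled⇒FiresSeq G (enabled G ≤M-after-t)
    where
    ≤M-split : ∀ s → preM N [ t ] s + preM N G s ≤ M s
    ≤M-split s = subst (_≤ M s) (preM-++ [ t ] G s) (≤M s)
    ≤M-after-t : ∀ s → preM N G s ≤ (M s ∸ preM N [ t ] s) + postM N [ t ] s
    ≤M-after-t s = ≤-∸-+ (postM N [ t ] s) (≤M-split s)
  ... | M' , r = M' , step ((λ s → ≤-trans (+-monoʳ-≤ (pre t s) z≤n) (≤M s)) , λ _ → refl) r

  Enabled⇒FS-++ : ∀ {σ M} G → FiresSeq N M₀ σ M → Enabled N M G → FS N (σ ++ G)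
  Enabled⇒FS-++ {σ} G σ→M en with Enabled⇒FiresSeq G en
  ... | M' , G→M' = M' , FiresSeq-++⁺ σ σ→M G→M'

  -- Each inequality •{t,u}(s) ≤ M(s) is decided in ℕ, so no excluded middle over S is needed.
  BinaryConflictFree⇒concurrent : BinaryConflictFree N → ∀ {M t u} → Reachable N M → t ≢ u →
    Enabled N M [ t ] → Enabled N M [ u ] → Enabled N M (t ∷ u ∷ [])
  BinaryConflictFree⇒concurrent bcf {M} {t} {u} reach t≢u en-t en-u =
    enabled (t ∷ u ∷ []) λ s →
      decidable-stable (preM N (t ∷ u ∷ []) s ≤? M s) λ ≰ → bcf M (t ∷ u ∷ []) reach refl (conflict s ≰)
    where
    restrictions : ∀ x → x ∈ t ∷ u ∷ [] → ∃[ H ] (Restrict N (t ∷ u ∷ []) x H × Enabled N M H)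
    restrictions _ (here refl)         = [ t ] , r-keep (r-drop (λ u≡t → t≢u (sym u≡t)) r-nil) , en-t
    restrictions _ (there (here refl)) = [ u ] , r-drop t≢u (r-keep r-nil) , en-u
    restrictions _ (there (there ()))
    conflict : ∀ s → ¬ preM N (t ∷ u ∷ []) s ≤ M s → SemConflict N M (t ∷ u ∷ [])
    conflict s ≰ = (λ ()) , (λ (_ , ≤M , _) → ≰ (≤M s)) , restrictions

open Firing

lemma7 : (N : Net) → BinaryConflictFree N →
    (σ : List (Net.T N)) (t u : Net.T N) → t ≢ u →
    FS N (σ ++ (t ∷ [])) → FS N (σ ++ (u ∷ [])) →
    FS N (σ ++ (t ∷ u ∷ [])) × FS N (σ ++ (u ∷ t ∷ [])) ×
    Equiv₀* N (σ ++ (t ∷ u ∷ [])) (σ ++ (u ∷ t ∷ []))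
lemma7 N bcf σ t u t≢u (_ , σt) (_ , σu)
  with FiresSeq-snoc⁻ N σ σt | FiresSeq-snoc⁻ N σ σu
... | M , σ→M , en-t | M' , σ→M' , en-u = σtu , σut , (σtu≡₀σut ◅ ε)
  where
  en-tu : Enabled N M (t ∷ u ∷ [])
  en-tu = BinaryConflictFree⇒concurrent N bcf (σ , σ→M) t≢u en-t
            (Enabled-resp N [ u ] (FiresSeq-deterministic N (λ _ → refl) σ→M σ→M') en-u)
  σtu : FS N (σ ++ (t ∷ u ∷ []))
  σtu = Enabled⇒FS-++ N (t ∷ u ∷ []) σ→M en-tu
  σut : FS N (σ ++ (u ∷ t ∷ []))
  σut = Enabled⇒FS-++ N (u ∷ t ∷ []) σ→M (Enabled-swap N {G = []} en-tu)
  σtu≡₀σut : Equiv₀ N (σ ++ (t ∷ u ∷ [])) (σ ++ (u ∷ t ∷ []))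
  σtu≡₀σut = σtu , σut , σ , t , u , [] , refl , refl , M , σ→M , en-tu
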